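{- Let $a_1,\dots,a_n$ be positive integers, $\mathcal{T}=[0,a_1]\times\cdots\times[0,a_n]$, and let $v\in\mathcal{T}\cap\mathbb{N}^n$ with $m_{\mathcal{T}}(v)>0$. Then either $v_i\equiv 0\pmod 2$ for all $i\in[n]$, or $v_i\equiv 1\pmod 2$ for all $i\in[n]$.
   Context: A corner of $\mathcal{T}$ is a point $w$ with $w_i\in\{0,a_i\}$ for all $i$. The billiard trajectory is the curve $\gamma$ starting at the origin with direction $d=(1,\dots,1)$, moving in a straight line; whenever it reaches the boundary hyperplane $x_i=0$ or $x_i=a_i$, the $i$-th component of its current direction is negated (several components simultaneously if several such hyperplanes are reached at once), and the motion stops when it reaches a corner other than the origin. Parametrize $\gamma:[0,L]\to\mathcal{T}$ so that on each linear piece $\gamma'(t)\in\{ -1,1\}^n$. The crossing number $m_{\mathcal{T}}(v)$ is the number of parameters $t\in[0,L]$ with $\gamma(t)=v$. Here $\mathbb{N}$ includes $0$. -}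

module Defs where

open import Data.Nat using (ℕ; zero; suc; _∸_; _≡ᵇ_; _<_; _≤_)
open import Data.Bool using (Bool; true; false; if_then_else_)
open import Data.Fin using (Fin)
open import Data.Product using (_×_; _,_; proj₁; ∃-syntax)
open import Data.Sum using (_⊎_)
open import Relation.Binary.PropositionalEquality using (_≡_)
open import Relation.Nullary using (¬_)

-- Starting at the origin with direction (1,...,1) and unit speed, the
-- trajectory is at lattice points exactly at integer times, and the motion of
-- each coordinate is independent of the others (a reflection only negates the
-- component whose hyperplane is hit).  State of one coordinate: (position,
-- direction), direction true = +1, false = -1.

coordStep : ℕ → ℕ × Bool → ℕ × Bool
coordStep a (p , d) =
  let p' = if d then suc p else p ∸ 1 in
  (p' , (if p' ≡ᵇ a then false else (if p' ≡ᵇ 0 then true else d)))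

billiardState : {n : ℕ} → (Fin n → ℕ) → ℕ → Fin n → ℕ × Bool
billiardState a zero    i = (0 , true)
billiardState a (suc t) i = coordStep (a i) (billiardState a t i)

γ : {n : ℕ} → (Fin n → ℕ) → ℕ → Fin n → ℕ
γ a t i = proj₁ (billiardState a t i)

IsCorner : {n : ℕ} → (Fin n → ℕ) → (Fin n → ℕ) → Set
IsCorner a w = ∀ i → (w i ≡ 0) ⊎ (w i ≡ a i)

-- t ∈ [0,L], where L is the first positive time at which γ is at a corner:
-- no positive time strictly before t is a corner time.
WithinStop : {n : ℕ} → (Fin n → ℕ) → ℕ → Set
WithinStop a t = ∀ s → 0 < s → s < t → ¬ IsCorner a (γ a s)

-- m_T(v) > 0 : some parameter t ∈ [0,L] has γ(t) = v
-- (for a lattice point v such t is necessarily an integer)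
CrossingPositive : {n : ℕ} → (Fin n → ℕ) → (Fin n → ℕ) → Set
CrossingPositive a v = ∃[ t ] (WithinStop a t × (∀ i → γ a t i ≡ v i))

{-# OPTIONS --safe #-}
-- Each coordinate moves independently by exactly one unit per time step, since
-- it never heads towards 0 while sitting at 0 (it would then have bounced off
-- the wall x_i = 0). Hence every coordinate of γ(t) has the parity of t, and so
-- all coordinates of a point on the trajectory share one parity.
module Submission where

open import Defs
open import Data.Nat using (ℕ; _≤_; _%_; zero; suc; _≡ᵇ_; s≤s; z≤n)
open import Data.Nat.DivMod using (%-distribˡ-+)
open import Data.Bool using (Bool; true; false; if_then_else_)
open import Data.Fin using (Fin)
open import Data.Product using (_×_; _,_; proj₁)
open import Data.Sum using (_⊎_; inj₁; inj₂)
import Data.Sum as Sum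
open import Relation.Binary.PropositionalEquality using (_≡_; refl; sym; trans; cong)

%2≡0⊎%2≡1 : ∀ n → n % 2 ≡ 0 ⊎ n % 2 ≡ 1
%2≡0⊎%2≡1 zero          = inj₁ refl
%2≡0⊎%2≡1 (suc zero)    = inj₂ refl
%2≡0⊎%2≡1 (suc (suc n)) = %2≡0⊎%2≡1 n

%2-suc-cong : ∀ m n → m % 2 ≡ n % 2 → suc m % 2 ≡ suc n % 2
%2-suc-cong m n eq = trans (%-distribˡ-+ 1 m 2)
  (trans (cong (λ r → suc r % 2) eq) (sym (%-distribˡ-+ 1 n 2)))

bounce : ℕ → ℕ → Bool → Bool
bounce a p d = if p ≡ᵇ a then false else (if p ≡ᵇ 0 then true else d)

-- Excludes (0 , false), the only state at which the p ∸ 1 of coordStep truncates.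
data WellDirected : ℕ × Bool → Set where
  ascending  : ∀ {p} → WellDirected (p , true)
  descending : ∀ {p} → WellDirected (suc p , false)

suc-wellDirected : ∀ p d → WellDirected (suc p , d)
suc-wellDirected p true  = ascending
suc-wellDirected p false = descending

bounce-wellDirected : ∀ {a} → 1 ≤ a → ∀ p d → WellDirected (p , bounce a p d)
bounce-wellDirected (s≤s z≤n) zero    d = ascending
bounce-wellDirected _         (suc p) d = suc-wellDirected p _

billiardState-wellDirected : ∀ {n} {a : Fin n → ℕ} → (∀ i → 1 ≤ a i) →
  ∀ t i → WellDirected (billiardState a t i)
billiardState-wellDirected ha zero    i = ascending
billiardState-wellDirected ha (suc t) i = bounce-wellDirected (ha i) _ _

coordStep-parity : ∀ a {s} → WellDirected s →
  proj₁ (coordStep a s) % 2 ≡ suc (proj₁ s) % 2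
coordStep-parity a ascending  = refl
coordStep-parity a descending = refl

γ-parity : ∀ {n} {a : Fin n → ℕ} → (∀ i → 1 ≤ a i) → ∀ t i → γ a t i % 2 ≡ t % 2
γ-parity ha zero    i = refl
γ-parity {a = a} ha (suc t) i = trans (coordStep-parity (a i) (billiardState-wellDirected ha t i))
  (%2-suc-cong (γ a t i) t (γ-parity ha t i))

lemma1 : (n : ℕ) (a : Fin n → ℕ) → (∀ i → 1 ≤ a i) →
    (v : Fin n → ℕ) → (∀ i → v i ≤ a i) → CrossingPositive a v →
    (∀ i → v i % 2 ≡ 0) ⊎ (∀ i → v i % 2 ≡ 1)
lemma1 n a ha v _ (t , _ , γt≡v) =
  Sum.map (λ t-even i → trans (v%2≡t%2 i) t-even) (λ t-odd i → trans (v%2≡t%2 i) t-odd)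
    (%2≡0⊎%2≡1 t)
  where
  v%2≡t%2 : ∀ i → v i % 2 ≡ t % 2
  v%2≡t%2 i = trans (cong (_% 2) (sym (γt≡v i))) (γ-parity ha t i)
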